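{- Let $n$ be an odd positive integer, $p$ a prime and $a\ge1$ with $p^a\mid n$. Suppose there is a prime $q$ with $n/3<q<n/2$ and $n-2q<p^a$. Then for every integer $k$ with $1\le k\le n-1$, $\binom{n}{k}$ is divisible by $p$ or by $q$. -}

module Submission where

-- Put d = p^a and m = n - 2q, so m < d and q ∣ n - m = 2q.
-- Suppose p ∤ C(n,k).  From the absorption identity k·C(n,k) = n·C(n-1,k-1)
-- and d ∣ n we get d ∣ k, and by the symmetry C(n,k) = C(n,n-k) also d ∣ n-k;
-- in particular k ≥ d > m and n - k ≥ d > m.
--   * If k < q, the falling factorial n(n-1)⋯(n-k+1) = C(n,k)·k! contains the
--     factor n - m = 2q, while the prime q does not divide k!; so q ∣ C(n,k).
--     The case n - k < q is the same after the symmetry.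
--   * Otherwise k ≥ q and n - k ≥ q are multiples of d whose sum n = 2q + m is
--     below 2q + d; two distinct multiples of d differ by at least d, so
--     k = n - k and n = 2k is even, a contradiction.

open import Data.Nat using (ℕ; _+_; _*_; _∸_; _^_; _≤_; _<_)
open import Data.Nat.Divisibility using (_∣_)
open import Data.Nat.Primality using (Prime)
open import Data.Nat.Combinatorics using (_C_)
open import Data.Sum using (_⊎_)
open import Relation.Nullary using (¬_)

open import Data.Nat.Base using (zero; suc; _!; s≤s; s≤s⁻¹; >-nonZero; nonTrivial⇒n>1)
open import Data.Nat.Properties
open import Data.Nat.Divisibility
open import Data.Nat.DivMod using (_/_; m/n*n≡m)
open import Data.Nat.Primality using (euclidsLemma; prime⇒nonZero; prime⇒nonTrivial)
open import Data.Nat.Combinatorics using (nCk≡nPk/k!; nCk≡nC[n∸k])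
open import Data.Nat.Combinatorics.Base using (_P_; _P′_)
open import Data.Nat.Combinatorics.Specification
  using (k!∣nP′k; nP′k≡n!/[n∸k]!; nPk≡n!/[n∸k]!; nP′k≡n[n∸1P′k∸1])
open import Data.Sum using (inj₁; inj₂)
open import Relation.Nullary using (Dec; yes; no; contradiction)
open import Relation.Binary.PropositionalEquality
open import Relation.Binary.Definitions using (tri<; tri≈; tri>)

binomial*factorial : ∀ {n k} → k ≤ n → (n C k) * k ! ≡ n P′ k
binomial*factorial {n} {k} k≤n = begin
  (n C k) * k !          ≡⟨ cong (_* k !) (nCk≡nPk/k! k≤n) ⟩
  ((n P k) / k !) * k !  ≡⟨ m/n*n≡m (subst (k ! ∣_) (sym P≡P′) (k!∣nP′k k≤n)) ⟩
  n P k                  ≡⟨ P≡P′ ⟩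
  n P′ k                 ∎
  where
  open ≡-Reasoning
  instance _ = k !≢0
  P≡P′ : n P k ≡ n P′ k
  P≡P′ = trans (nPk≡n!/[n∸k]! k≤n) (sym (nP′k≡n!/[n∸k]! k≤n))

absorption : ∀ {n k} → k ≤ n → suc k * (suc n C suc k) ≡ suc n * (n C k)
absorption {n} {k} k≤n = *-cancelʳ-≡ (suc k * (suc n C suc k)) (suc n * (n C k)) (k !) {{k !≢0}} (begin
  suc k * (suc n C suc k) * k !  ≡⟨ cong (_* k !) (*-comm (suc k) (suc n C suc k)) ⟩
  (suc n C suc k) * suc k * k !  ≡⟨ *-assoc (suc n C suc k) (suc k) (k !) ⟩
  (suc n C suc k) * suc k !      ≡⟨ binomial*factorial (s≤s k≤n) ⟩
  suc n P′ suc k                 ≡⟨ nP′k≡n[n∸1P′k∸1] (suc n) (suc k) ⟩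
  suc n * (n P′ k)               ≡⟨ cong (suc n *_) (binomial*factorial k≤n) ⟨
  suc n * ((n C k) * k !)        ≡⟨ *-assoc (suc n) (n C k) (k !) ⟨
  suc n * (n C k) * k !          ∎)
  where open ≡-Reasoning

∣-falling : ∀ {d n j} k → j < k → d ∣ n ∸ j → d ∣ n P′ k
∣-falling {n = n} {j} (suc k) j<1+k d∣n∸j with m≤n⇒m<n∨m≡n (s≤s⁻¹ j<1+k)
... | inj₁ j<k  = ∣n⇒∣m*n (n ∸ k) (∣-falling k j<k d∣n∸j)
... | inj₂ refl = ∣m⇒∣m*n (n P′ k) d∣n∸j

prime∤factorial : ∀ {q} k → Prime q → k < q → ¬ (q ∣ k !)
prime∤factorial {q} zero q-prime _ q∣1 =
  <⇒≱ (nonTrivial⇒n>1 q {{prime⇒nonTrivial q-prime}}) (∣⇒≤ q∣1)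
prime∤factorial (suc k) q-prime 1+k<q q∣k! with euclidsLemma (suc k) (k !) q-prime q∣k!
... | inj₁ q∣1+k = <⇒≱ 1+k<q (∣⇒≤ q∣1+k)
... | inj₂ q∣k!′ = prime∤factorial k q-prime (<-trans (n<1+n k) 1+k<q) q∣k!′

-- A prime q > k dividing one of n, n-1, …, n-k+1 divides C(n,k):
-- it divides C(n,k)·k! but not k!.
prime∣binomial : ∀ {q n j k} → Prime q → k ≤ n → k < q → j < k → q ∣ n ∸ j → q ∣ n C k
prime∣binomial {q} {n} {j} {k} q-prime k≤n k<q j<k q∣n∸j
  with euclidsLemma (n C k) (k !) q-prime q∣C*k!
  where
  q∣C*k! : q ∣ (n C k) * k !
  q∣C*k! = subst (q ∣_) (sym (binomial*factorial k≤n)) (∣-falling k j<k q∣n∸j)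
... | inj₁ q∣C  = q∣C
... | inj₂ q∣k! = contradiction q∣k! (prime∤factorial k q-prime k<q)

prime-power-cancel : ∀ {p} a {x c} → Prime p → ¬ (p ∣ c) → p ^ a ∣ x * c → p ^ a ∣ x
prime-power-cancel zero {x} _ _ _ = 1∣ x
prime-power-cancel {p} (suc a) {x} {c} p-prime p∤c p^a+1∣xc
  with euclidsLemma x c p-prime (∣-trans (m∣m*n (p ^ a)) p^a+1∣xc)
... | inj₂ p∣c = contradiction p∣c p∤c
... | inj₁ (divides y refl) =
  subst (p * p ^ a ∣_) (*-comm p y) (*-monoʳ-∣ p (prime-power-cancel a p-prime p∤c p^a∣yc))
  where
  instance _ = prime⇒nonZero p-prime
  p^a∣yc : p ^ a ∣ y * c
  p^a∣yc = *-cancelˡ-∣ p (subst (p * p ^ a ∣_) (trans (cong (_* c) (*-comm y p)) (*-assoc p y c)) p^a+1∣xc)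

-- If p^a ∣ n but p ∤ C(n,k) for 1 ≤ k ≤ n, then p^a ∣ k, because
-- p^a ∣ n·C(n-1,k-1) = k·C(n,k).
prime-power∣index : ∀ {p} a {n k} → Prime p → p ^ a ∣ n → 1 ≤ k → k ≤ n → ¬ (p ∣ n C k) → p ^ a ∣ k
prime-power∣index {p} a {suc n} {suc k} p-prime p^a∣n _ (s≤s k≤n) p∤C =
  prime-power-cancel a p-prime p∤C
    (subst (p ^ a ∣_) (sym (absorption k≤n)) (∣-trans p^a∣n (m∣m*n (n C k))))

multiple-gap : ∀ {d x y} → d ∣ x → d ∣ y → x < y → x + d ≤ y
multiple-gap {d} {x} {y} d∣x d∣y x<y =
  subst (x + d ≤_) (m+[n∸m]≡n (<⇒≤ x<y)) (+-monoʳ-≤ x d≤y∸x)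
  where
  d∣y∸x : d ∣ y ∸ x
  d∣y∸x = ∣m+n∣m⇒∣n (subst (d ∣_) (sym (m+[n∸m]≡n (<⇒≤ x<y))) d∣y) d∣x
  d≤y∸x : d ≤ y ∸ x
  d≤y∸x = ∣⇒≤ {{>-nonZero (m<n⇒0<n∸m x<y)}} d∣y∸x

sum-lower-bound : ∀ {d q u v} → q ≤ u → u + d ≤ v → 2 * q + d ≤ u + v
sum-lower-bound {d} {q} {u} {v} q≤u u+d≤v = begin
  2 * q + d    ≡⟨ cong (λ t → q + t + d) (+-identityʳ q) ⟩
  q + q + d    ≡⟨ +-assoc q q d ⟩
  q + (q + d)  ≤⟨ +-mono-≤ q≤u (+-monoˡ-≤ d q≤u) ⟩
  u + (u + d)  ≤⟨ +-monoʳ-≤ u u+d≤v ⟩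
  u + v        ∎
  where open ≤-Reasoning

-- Two multiples of d that are at least q and sum to less than 2q + d coincide:
-- otherwise the larger one is at least the smaller plus d.
multiples-collide : ∀ {d q x y} → d ∣ x → d ∣ y → q ≤ x → q ≤ y → x + y < 2 * q + d → x ≡ y
multiples-collide {d} {q} {x} {y} d∣x d∣y q≤x q≤y sum< with <-cmp x y
... | tri≈ _ x≡y _ = x≡y
... | tri< x<y _ _ = contradiction (sum-lower-bound q≤x (multiple-gap d∣x d∣y x<y)) (<⇒≱ sum<)
... | tri> _ _ y<x = contradiction
  (subst (2 * q + d ≤_) (+-comm y x) (sum-lower-bound q≤y (multiple-gap d∣y d∣x y<x))) (<⇒≱ sum<)

balanced⇒even : ∀ {n k} → k ≤ n → k ≡ n ∸ k → 2 ∣ n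
balanced⇒even {n} {k} k≤n k≡n∸k = divides k (begin
  n            ≡⟨ m+[n∸m]≡n k≤n ⟨
  k + (n ∸ k)  ≡⟨ cong (k +_) k≡n∸k ⟨
  k + k        ≡⟨ cong (k +_) (+-identityʳ k) ⟨
  2 * k        ≡⟨ *-comm 2 k ⟩
  k * 2        ∎)
  where open ≡-Reasoning

-- If 0 < k < n and
-- d divides both k and n - k, then q ∣ C(n,k): if k < q (or n - k < q, using
-- C(n,k) = C(n,n-k)) then prime∣binomial applies to the factor 2q, and k, n - k
-- cannot both be ≥ q by multiples-collide, since n is odd.
prime∣binomial-of-multiples : ∀ {n q d k} → Prime q → ¬ (2 ∣ n) → 2 * q < n → n ∸ 2 * q < d →
  1 ≤ k → k < n → d ∣ k → d ∣ n ∸ k → q ∣ n C k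
prime∣binomial-of-multiples {n} {q} {d} {k} q-prime n-odd 2q<n m<d 1≤k k<n d∣k d∣n∸k =
  by-size (k <? q) (n ∸ k <? q)
  where
  -- q divides the factor n - (n - 2q) = 2q of the falling factorial
  q∣n∸m : q ∣ n ∸ (n ∸ 2 * q)
  q∣n∸m = subst (q ∣_) (sym (m∸[m∸n]≡n (<⇒≤ 2q<n))) (∣n⇒∣m*n 2 ∣-refl)

  m<multiple : ∀ {x} → 1 ≤ x → d ∣ x → n ∸ 2 * q < x
  m<multiple 1≤x d∣x = <-≤-trans m<d (∣⇒≤ {{>-nonZero 1≤x}} d∣x)

  sum< : k + (n ∸ k) < 2 * q + d
  sum< = begin-strict
    k + (n ∸ k)          ≡⟨ m+[n∸m]≡n (<⇒≤ k<n) ⟩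
    n                    ≡⟨ m+[n∸m]≡n (<⇒≤ 2q<n) ⟨
    2 * q + (n ∸ 2 * q)  <⟨ +-monoʳ-< (2 * q) m<d ⟩
    2 * q + d            ∎
    where open ≤-Reasoning

  by-size : Dec (k < q) → Dec (n ∸ k < q) → q ∣ n C k
  by-size (yes k<q) _ =
    prime∣binomial q-prime (<⇒≤ k<n) k<q (m<multiple 1≤k d∣k) q∣n∸m
  by-size _ (yes n∸k<q) = subst (q ∣_) (sym (nCk≡nC[n∸k] (<⇒≤ k<n)))
    (prime∣binomial q-prime (m∸n≤m n k) n∸k<q (m<multiple (m<n⇒0<n∸m k<n) d∣n∸k) q∣n∸m)
  by-size (no k≮q) (no n∸k≮q) = contradiction (balanced⇒even (<⇒≤ k<n) k≡n∸k) n-odd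
    where
    k≡n∸k : k ≡ n ∸ k
    k≡n∸k = multiples-collide d∣k d∣n∸k (≮⇒≥ k≮q) (≮⇒≥ n∸k≮q) sum<

theorem3p3 : (n p a q : ℕ) → 1 ≤ n → ¬ (2 ∣ n) → Prime p → 1 ≤ a → p ^ a ∣ n →
    Prime q → n < 3 * q → 2 * q < n → n ∸ 2 * q < p ^ a →
    (k : ℕ) → 1 ≤ k → k ≤ n ∸ 1 → (p ∣ n C k) ⊎ (q ∣ n C k)
theorem3p3 n p a q 1≤n n-odd p-prime _ p^a∣n q-prime _ 2q<n m<p^a k 1≤k k≤n∸1 with p ∣? n C k
... | yes p∣C = inj₁ p∣C
... | no p∤C = inj₂ (prime∣binomial-of-multiples q-prime n-odd 2q<n m<p^a 1≤k k<n p^a∣k p^a∣n∸k)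
  where
  k<n : k < n
  k<n = subst (_≤ n) (+-comm k 1) (m≤o∸n⇒m+n≤o k 1≤n k≤n∸1)
  p∤C′ : ¬ (p ∣ n C (n ∸ k))
  p∤C′ p∣C′ = p∤C (subst (p ∣_) (sym (nCk≡nC[n∸k] (<⇒≤ k<n))) p∣C′)
  p^a∣k : p ^ a ∣ k
  p^a∣k = prime-power∣index a p-prime p^a∣n 1≤k (<⇒≤ k<n) p∤C
  p^a∣n∸k : p ^ a ∣ n ∸ k
  p^a∣n∸k = prime-power∣index a p-prime p^a∣n (m<n⇒0<n∸m k<n) (m∸n≤m n k) p∤C′
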